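{- Let $k\geq 1$ and $r\leq k$ be integers. Suppose that in every $(k+1)$-connected graph, every pair of longest cycles intersect in at least $r+1$ vertices. Then in every $k$-connected graph, every pair of longest paths intersect in at least $r$ vertices.
   Context: All graphs are finite and simple; paths and cycles are simple (no repeated vertices). The length of a path or cycle is its number of edges; a longest path (cycle) is one of maximum length in the graph. The intersection of two paths or cycles is the set of vertices they share. A graph $G$ is $k$-connected if for any two distinct vertices $u,v$ of $G$ there exist $k$ internally disjoint $u$-$v$ paths. -}

module Defs where

open import Data.Nat using (ℕ; suc; _≤_; _∸_)
open import Data.Fin using (Fin)
open import Data.Bool using (Bool; true; false)
open import Data.List using (List; []; length)
open import Data.List.Base using (head; last)
open import Data.Maybe using (just)
open import Data.List.Relation.Unary.All using (All)
open import Data.List.Relation.Unary.Unique.Propositional using (Unique)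
open import Data.List.Relation.Unary.Linked using (Linked)
open import Data.List.Membership.Propositional using (_∈_)
open import Data.Product using (Σ; ∃; _×_)
open import Data.Sum using (_⊎_)
open import Relation.Binary.PropositionalEquality using (_≡_; _≢_)

record Graph : Set where
  field
    n      : ℕ
    adj    : Fin n → Fin n → Bool
    sym    : ∀ x y → adj x y ≡ adj y x
    irrefl : ∀ x → adj x x ≡ false

open Graph public

Vertex : Graph → Set
Vertex G = Fin (n G)

Adj : (G : Graph) → Vertex G → Vertex G → Set
Adj G x y = adj G x y ≡ true

IsPath : (G : Graph) → List (Vertex G) → Set
IsPath G p = (p ≢ []) × Unique p × Linked (Adj G) p

-- length of a path = number of edges
pathLength : ∀ {A : Set} → List A → ℕ
pathLength p = length p ∸ 1

IsPathBetween : (G : Graph) → Vertex G → Vertex G → List (Vertex G) → Set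
IsPathBetween G u v p = IsPath G p × head p ≡ just u × last p ≡ just v

IsCycle : (G : Graph) → List (Vertex G) → Set
IsCycle G c = (3 ≤ length c) × Unique c × Linked (Adj G) c
  × Σ (Vertex G) (λ x → Σ (Vertex G) (λ y →
      head c ≡ just x × last c ≡ just y × Adj G y x))

-- length of a cycle = number of edges = number of vertices
cycleLength : ∀ {A : Set} → List A → ℕ
cycleLength c = length c

LongestPath : (G : Graph) → List (Vertex G) → Set
LongestPath G p = IsPath G p × (∀ q → IsPath G q → pathLength q ≤ pathLength p)

LongestCycle : (G : Graph) → List (Vertex G) → Set
LongestCycle G c = IsCycle G c × (∀ d → IsCycle G d → cycleLength d ≤ cycleLength c)

KConnected : ℕ → Graph → Set
KConnected k G = (suc k ≤ n G) × (∀ (u v : Vertex G) → u ≢ v →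
  Σ (Fin k → List (Vertex G)) (λ P →
    (∀ i → IsPathBetween G u v (P i)) ×
    (∀ i j → i ≢ j → P i ≢ P j) ×
    (∀ i j → i ≢ j → ∀ x → x ∈ P i → x ∈ P j → (x ≡ u) ⊎ (x ≡ v))))

ShareAtLeast : ∀ {A : Set} → ℕ → List A → List A → Set
ShareAtLeast {A} r p q = Σ (List A) (λ S → Unique S × r ≤ length S × All (_∈ p) S × All (_∈ q) S)

-- Let G be k-connected and let G⁺ be the cone over G: a new apex vertex joined to every
-- vertex of G. Then G⁺ is (k+1)-connected. A longest path P of G, closed up through the
-- apex, is a cycle of G⁺ of length |P| + 1. No cycle of G⁺ is longer: one avoiding the
-- apex is a path of G, and deleting the apex from one through it leaves a path of G.
-- Hence two longest paths P, Q of G give two longest cycles of G⁺, which share at least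
-- r + 1 vertices; at most one of them is the apex, so P and Q share at least r.
module Submission where

open import Defs
open import Data.Nat using (ℕ; zero; suc; _≤_; z≤n; s≤s)
open import Data.Nat.Properties using (≤-trans; ≤-reflexive; ≤-pred; m≤n⇒m≤1+n; module ≤-Reasoning)
open import Data.Fin using (Fin; zero; suc; fromℕ<)
import Data.Fin as Fin
open import Data.Fin.Properties using (suc-injective; _≟_)
open import Data.Bool using (Bool; true; false)
open import Data.List using (List; []; _∷_; _++_; map; length; head; last)
open import Data.List.Properties using (length-map; length-++-comm; map-injective; head-map; last-map; ∷-injective)
open import Data.Maybe using (just; nothing)
import Data.Maybe as Maybe
open import Data.Maybe.Relation.Binary.Connected using (Connected; just; just-nothing; nothing-just; nothing)
open import Data.List.Relation.Unary.All as All using (All; []; _∷_)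
open import Data.List.Relation.Unary.Any using (here; there)
open import Data.List.Relation.Unary.AllPairs using ([]; _∷_)
open import Data.List.Relation.Unary.Unique.Propositional using (Unique)
import Data.List.Relation.Unary.Unique.Propositional.Properties as Unique
open import Data.List.Relation.Unary.Linked using (Linked; []; [-]; _∷_)
import Data.List.Relation.Unary.Linked as Linked
import Data.List.Relation.Unary.Linked.Properties as Linked
open import Data.List.Relation.Binary.Permutation.Propositional using (↭⇒↭ₛ)
open import Data.List.Relation.Binary.Permutation.Propositional.Properties using (++-comm)
import Data.List.Relation.Binary.Permutation.Setoid.Properties as Permutation
open import Data.List.Membership.Propositional using (_∈_; _∉_)
open import Data.List.Membership.Propositional.Properties using (∈-map⁻; ∈-∃++)
open import Data.Product using (Σ; ∃; ∃₂; _×_; _,_; proj₁; proj₂)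
open import Data.Sum using (_⊎_; inj₁; inj₂)
import Data.Sum as Sum
open import Data.Empty using (⊥-elim)
open import Function using (_∘_)
open import Relation.Nullary using (yes; no)
open import Relation.Binary.PropositionalEquality
  using (_≡_; _≢_; refl; trans; cong; subst; setoid)
import Relation.Binary.PropositionalEquality as ≡

module _ {A : Set} where

  last-∈ : ∀ xs {z : A} → last xs ≡ just z → z ∈ xs
  last-∈ (x ∷ [])     refl = here refl
  last-∈ (x ∷ y ∷ xs) eq   = there (last-∈ (y ∷ xs) eq)

  last-∷ : ∀ (x : A) xs → ∃ λ z → last (x ∷ xs) ≡ just z
  last-∷ x []       = x , refl
  last-∷ x (y ∷ xs) = last-∷ y xs

  last-++-∷ : ∀ (xs : List A) y ys → last (xs ++ y ∷ ys) ≡ last (y ∷ ys)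
  last-++-∷ []           y ys = refl
  last-++-∷ (x ∷ [])     y ys = refl
  last-++-∷ (x ∷ x′ ∷ xs) y ys = last-++-∷ (x′ ∷ xs) y ys

  Unique-++-comm : ∀ (xs ys : List A) → Unique (xs ++ ys) → Unique (ys ++ xs)
  Unique-++-comm xs ys = Permutation.Unique-resp-↭ (setoid A) (↭⇒↭ₛ (++-comm xs ys))

  module _ {R : A → A → Set} where

    Linked-++⁻ˡ : ∀ xs {ys} → Linked R (xs ++ ys) → Linked R xs
    Linked-++⁻ˡ []           _          = []
    Linked-++⁻ˡ (x ∷ [])     _          = [-]
    Linked-++⁻ˡ (x ∷ y ∷ xs) (r ∷ rxs) = r ∷ Linked-++⁻ˡ (y ∷ xs) rxs

    Linked-++⁻ʳ : ∀ xs {ys} → Linked R (xs ++ ys) → Linked R ys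
    Linked-++⁻ʳ []       rys = rys
    Linked-++⁻ʳ (x ∷ xs) rxs = Linked-++⁻ʳ xs (Linked.tail rxs)

    Connected-nothingʳ : ∀ m → Connected R m nothing
    Connected-nothingʳ (just _) = just-nothing
    Connected-nothingʳ nothing  = nothing

    Connected-nothingˡ : ∀ m → Connected R nothing m
    Connected-nothingˡ (just _) = nothing-just
    Connected-nothingˡ nothing  = nothing

    closingEdge : ∀ xs v ys {x y} → head (xs ++ v ∷ ys) ≡ just x →
                  last (xs ++ v ∷ ys) ≡ just y → R y x →
                  Connected R (last ys) (head xs)
    closingEdge []       v ys       _    _   _  = Connected-nothingʳ (last ys)
    closingEdge (a ∷ xs) v []       _    _   _  = Connected-nothingˡ (just a)
    closingEdge (a ∷ xs) v (b ∷ ys) refl lst ryx =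
      subst (λ m → Connected R m (just a)) (≡.sym (trans (≡.sym (last-++-∷ (a ∷ xs) v (b ∷ ys))) lst)) (just ryx)

length>0⇒≢[] : ∀ {A : Set} {xs : List A} {k} → suc k ≤ length xs → xs ≢ []
length>0⇒≢[] {xs = x ∷ xs} _ ()

module _ (G : Graph) where

  Adj⇒≢ : ∀ {u v} → Adj G u v → u ≢ v
  Adj⇒≢ {u} uv refl with trans (≡.sym uv) (irrefl G u)
  ... | ()

  Adj-sym : ∀ {u v} → Adj G u v → Adj G v u
  Adj-sym {u} {v} uv = trans (Graph.sym G v u) uv

  IsCycle-delete : ∀ xs v ys → IsCycle G (xs ++ v ∷ ys) → IsPath G (ys ++ xs) × v ∉ ys ++ xs
  IsCycle-delete xs v ys (3≤len , uniq , linked , x , y , hd , lst , yx) =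
    (nonEmpty , uniqueRest , linked′) , Unique.Unique[x∷xs]⇒x∉xs rotated
    where
    rotated : Unique (v ∷ ys ++ xs)
    rotated = Unique-++-comm xs (v ∷ ys) uniq
    uniqueRest : Unique (ys ++ xs)
    uniqueRest with rotated
    ... | _ ∷ u = u
    nonEmpty : ys ++ xs ≢ []
    nonEmpty = length>0⇒≢[] (≤-pred (subst (3 ≤_) (length-++-comm xs (v ∷ ys)) 3≤len))
    linked′ : Linked (Adj G) (ys ++ xs)
    linked′ = Linked.++⁺ (Linked.tail (Linked-++⁻ʳ xs linked))
                         (closingEdge xs v ys hd lst yx)
                         (Linked-++⁻ˡ xs linked)

  edgePath : ∀ {u v} → Adj G u v → IsPath G (u ∷ v ∷ [])
  edgePath uv = (λ ()) , (Adj⇒≢ uv ∷ []) ∷ [] ∷ [] , uv ∷ [-]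

  LongestPath⇒length≤ : ∀ {P q} → LongestPath G P → IsPath G q → length q ≤ length P
  LongestPath⇒length≤ {[]}    ((ne , _) , _) _ = ⊥-elim (ne refl)
  LongestPath⇒length≤ {_ ∷ _} {[]} _ _ = z≤n
  LongestPath⇒length≤ {_ ∷ _} {_ ∷ _} (_ , longest) q = s≤s (longest _ q)

InternallyDisjointPaths : (G : Graph) → ℕ → Vertex G → Vertex G → Set
InternallyDisjointPaths G k u v = Σ (Fin k → List (Vertex G)) λ P →
  (∀ i → IsPathBetween G u v (P i)) ×
  (∀ i j → i ≢ j → P i ≢ P j) ×
  (∀ i j → i ≢ j → ∀ x → x ∈ P i → x ∈ P j → (x ≡ u) ⊎ (x ≡ v))

module _ (G : Graph) {u v : Vertex G} where

  InternallyDisjointPaths-∷ : ∀ {k} W → IsPathBetween G u v W → (F : InternallyDisjointPaths G k u v) →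
    (∀ i → W ≢ proj₁ F i) → (∀ i x → x ∈ W → x ∈ proj₁ F i → (x ≡ u) ⊎ (x ≡ v)) →
    InternallyDisjointPaths G (suc k) u v
  InternallyDisjointPaths-∷ W isW (P , isP , distinct , disjoint) W≢P W∩P =
    P′ , isP′ , distinct′ , disjoint′
    where
    P′ : Fin (suc _) → List (Vertex G)
    P′ zero    = W
    P′ (suc i) = P i
    isP′ : ∀ i → IsPathBetween G u v (P′ i)
    isP′ zero    = isW
    isP′ (suc i) = isP i
    distinct′ : ∀ i j → i ≢ j → P′ i ≢ P′ j
    distinct′ zero    zero    i≢j = ⊥-elim (i≢j refl)
    distinct′ zero    (suc j) _   = W≢P j
    distinct′ (suc i) zero    _   = W≢P i ∘ ≡.sym
    distinct′ (suc i) (suc j) i≢j = distinct i j (i≢j ∘ cong suc)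
    disjoint′ : ∀ i j → i ≢ j → ∀ x → x ∈ P′ i → x ∈ P′ j → (x ≡ u) ⊎ (x ≡ v)
    disjoint′ zero    zero    i≢j = ⊥-elim (i≢j refl)
    disjoint′ zero    (suc j) _   x x∈W x∈P = W∩P j x x∈W x∈P
    disjoint′ (suc i) zero    _   x x∈P x∈W = W∩P i x x∈W x∈P
    disjoint′ (suc i) (suc j) i≢j = disjoint i j (i≢j ∘ cong suc)

  commonNeighbourPaths : ∀ {k} (m : Fin k → Vertex G) → Adj G u v →
    (∀ i → Adj G u (m i)) → (∀ i → Adj G (m i) v) → (∀ i j → i ≢ j → m i ≢ m j) →
    InternallyDisjointPaths G (suc k) u v
  commonNeighbourPaths m uv um mv m-injective =
    InternallyDisjointPaths-∷ (u ∷ v ∷ []) isEdge (P , isP , distinct , disjoint)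
      (λ _ ()) (λ _ x x∈W _ → endpoint x∈W)
    where
    isEdge : IsPathBetween G u v (u ∷ v ∷ [])
    isEdge = edgePath G uv , refl , refl
    endpoint : ∀ {x} → x ∈ u ∷ v ∷ [] → (x ≡ u) ⊎ (x ≡ v)
    endpoint (here x≡u)         = inj₁ x≡u
    endpoint (there (here x≡v)) = inj₂ x≡v
    P : Fin _ → List (Vertex G)
    P i = u ∷ m i ∷ v ∷ []
    isP : ∀ i → IsPathBetween G u v (P i)
    isP i = ((λ ()) ,
             (Adj⇒≢ G (um i) ∷ Adj⇒≢ G uv ∷ []) ∷ (Adj⇒≢ G (mv i) ∷ []) ∷ [] ∷ [] ,
             um i ∷ mv i ∷ [-]) ,
            refl , refl
    distinct : ∀ i j → i ≢ j → P i ≢ P j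
    distinct i j i≢j eq = m-injective i j i≢j (proj₁ (∷-injective (proj₂ (∷-injective eq))))
    disjoint : ∀ i j → i ≢ j → ∀ x → x ∈ P i → x ∈ P j → (x ≡ u) ⊎ (x ≡ v)
    disjoint i j i≢j x (here x≡u)                 _                           = inj₁ x≡u
    disjoint i j i≢j x (there (there (here x≡v))) _                           = inj₂ x≡v
    disjoint i j i≢j x (there (here _))           (here x≡u)                  = inj₁ x≡u
    disjoint i j i≢j x (there (here _))           (there (there (here x≡v))) = inj₂ x≡v
    disjoint i j i≢j x (there (here x≡mi))        (there (here x≡mj))         =
      ⊥-elim (m-injective i j i≢j (trans (≡.sym x≡mi) x≡mj))

  startEdge : ∀ {p} → u ≢ v → IsPathBetween G u v p → ∃₂ λ y (rest : List (Vertex G)) → p ≡ u ∷ y ∷ rest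
  startEdge {[]}          _   ((p≢[] , _) , _) = ⊥-elim (p≢[] refl)
  startEdge {_ ∷ []}      u≢v (_ , refl , refl) = ⊥-elim (u≢v refl)
  startEdge {_ ∷ y ∷ rest} _  (_ , refl , _)    = y , rest , refl

  directPath : ∀ {y} {rest : List (Vertex G)} → IsPathBetween G u v (u ∷ y ∷ rest) → y ≡ v →
               _≡_ {A = List (Vertex G)} (u ∷ y ∷ rest) (u ∷ v ∷ [])
  directPath {rest = []}     _                                    refl = refl
  directPath {rest = r ∷ rs} ((_ , (_ ∷ v∉rest ∷ _) , _) , _ , lst) refl =
    ⊥-elim (All.lookup v∉rest (last-∈ (r ∷ rs) lst) refl)

  -- Internal disjointness forces the second vertices to differ, unless both are v,
  -- in which case both paths are the edge u v.
  secondVertices : ∀ {k} → u ≢ v → InternallyDisjointPaths G k u v →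
    Σ (Fin k → Vertex G) λ y → (∀ i → Adj G u (y i)) × (∀ i j → i ≢ j → y i ≢ y j)
  secondVertices u≢v (P , isP , distinct , disjoint) = y , adjacent , injective
    where
    y : ∀ i → Vertex G
    y i = proj₁ (startEdge u≢v (isP i))
    shape : ∀ i → P i ≡ u ∷ y i ∷ _
    shape i = proj₂ (proj₂ (startEdge u≢v (isP i)))
    isP′ : ∀ i → IsPathBetween G u v (u ∷ y i ∷ _)
    isP′ i = subst (IsPathBetween G u v) (shape i) (isP i)
    adjacent : ∀ i → Adj G u (y i)
    adjacent i = Linked.head (proj₂ (proj₂ (proj₁ (isP′ i))))
    y∈P : ∀ i → y i ∈ P i
    y∈P i = subst (y i ∈_) (≡.sym (shape i)) (there (here refl))
    direct : ∀ i → y i ≡ v → P i ≡ u ∷ v ∷ []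
    direct i yi≡v = trans (shape i) (directPath (isP′ i) yi≡v)
    injective : ∀ i j → i ≢ j → y i ≢ y j
    injective i j i≢j yi≡yj with disjoint i j i≢j (y i) (y∈P i) (subst (_∈ P j) (≡.sym yi≡yj) (y∈P j))
    ... | inj₁ yi≡u = Adj⇒≢ G (adjacent i) (≡.sym yi≡u)
    ... | inj₂ yi≡v = distinct i j i≢j (trans (direct i yi≡v) (≡.sym (direct j (trans (≡.sym yi≡yj) yi≡v))))

otherVertex : ∀ {m} → 2 ≤ m → (v : Fin m) → ∃ λ x → v ≢ x
otherVertex {suc zero}    (s≤s ()) zero
otherVertex {suc (suc _)} _ zero    = suc zero , λ ()
otherVertex {suc (suc _)} _ (suc _) = zero , λ ()

KConnected⇒neighbours : ∀ {k} (G : Graph) → KConnected k G → ∀ v →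
  Σ (Fin k → Vertex G) λ y → (∀ i → Adj G v (y i)) × (∀ i j → i ≢ j → y i ≢ y j)
KConnected⇒neighbours {zero}  G _              v = (λ ()) , (λ ()) , λ ()
KConnected⇒neighbours {suc k} G (k<n , paths) v with otherVertex (≤-trans (s≤s (s≤s z≤n)) k<n) v
... | x , v≢x = secondVertices G v≢x (paths v x v≢x)

-- The apex of the cone is zero; the vertices of G are embedded by suc.
coneAdj : (G : Graph) → Fin (suc (n G)) → Fin (suc (n G)) → Bool
coneAdj G zero    zero    = false
coneAdj G zero    (suc _) = true
coneAdj G (suc _) zero    = true
coneAdj G (suc x) (suc y) = adj G x y

cone : Graph → Graph
cone G = record { n = suc (n G) ; adj = coneAdj G ; sym = coneAdj-sym ; irrefl = coneAdj-irrefl }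
  where
  coneAdj-sym : ∀ x y → coneAdj G x y ≡ coneAdj G y x
  coneAdj-sym zero    zero    = refl
  coneAdj-sym zero    (suc _) = refl
  coneAdj-sym (suc _) zero    = refl
  coneAdj-sym (suc x) (suc y) = Graph.sym G x y
  coneAdj-irrefl : ∀ x → coneAdj G x x ≡ false
  coneAdj-irrefl zero    = refl
  coneAdj-irrefl (suc x) = irrefl G x

zero∉map-suc : ∀ {m} (xs : List (Fin m)) → zero ∉ map suc xs
zero∉map-suc xs z∈ with ∈-map⁻ Fin.suc z∈
... | _ , _ , ()

∈-map-suc⁻ : ∀ {m} {x : Fin m} {xs} → suc x ∈ map suc xs → x ∈ xs
∈-map-suc⁻ sx∈ with ∈-map⁻ Fin.suc sx∈
... | _ , y∈ , refl = y∈

module _ (G : Graph) where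

  lift-IsPath : ∀ {p} → IsPath G p → IsPath (cone G) (map suc p)
  lift-IsPath {[]}    (p≢[] , _)      = ⊥-elim (p≢[] refl)
  lift-IsPath {_ ∷ _} (_ , uniq , lk) = (λ ()) , Unique.map⁺ suc-injective uniq , Linked.map⁺ lk

  unlift-IsPath : ∀ {p} → IsPath (cone G) (map suc p) → IsPath G p
  unlift-IsPath {[]}    (p≢[] , _)      = ⊥-elim (p≢[] refl)
  unlift-IsPath {_ ∷ _} (_ , uniq , lk) = (λ ()) , Unique.map⁻ uniq , Linked.map⁻ lk

  lift-IsPathBetween : ∀ {u v p} → IsPathBetween G u v p → IsPathBetween (cone G) (suc u) (suc v) (map suc p)
  lift-IsPathBetween {p = p} (isP , hd , lst) =
    lift-IsPath isP , trans (head-map p) (cong (Maybe.map suc) hd) , trans (last-map suc p) (cong (Maybe.map suc) lst)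

  lift-InternallyDisjointPaths : ∀ {k u v} → InternallyDisjointPaths G k u v →
    InternallyDisjointPaths (cone G) k (suc u) (suc v)
  lift-InternallyDisjointPaths (P , isP , distinct , disjoint) =
    map suc ∘ P , lift-IsPathBetween ∘ isP ,
    (λ i j i≢j → distinct i j i≢j ∘ map-injective suc-injective) , disjoint′
    where
    disjoint′ : ∀ i j → _ → ∀ x → x ∈ map suc (P i) → x ∈ map suc (P j) → _
    disjoint′ i j i≢j x x∈Pi x∈Pj with ∈-map⁻ Fin.suc x∈Pi
    ... | y , y∈Pi , refl =
      Sum.map (cong suc) (cong suc) (disjoint i j i≢j y y∈Pi (∈-map-suc⁻ x∈Pj))

  cone-KConnected : ∀ {k} → KConnected k G → KConnected (suc k) (cone G)
  cone-KConnected {k} kc@(k<n , paths) = s≤s k<n , conePaths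
    where
    conePaths : ∀ u v → u ≢ v → InternallyDisjointPaths (cone G) (suc k) u v
    conePaths zero    zero    u≢v = ⊥-elim (u≢v refl)
    conePaths zero    (suc b) _   with KConnected⇒neighbours G kc b
    ... | y , by , y-injective =
      commonNeighbourPaths (cone G) (suc ∘ y) refl (λ _ → refl) (λ i → Adj-sym G (by i))
        (λ i j i≢j → y-injective i j i≢j ∘ suc-injective)
    conePaths (suc a) zero    _   with KConnected⇒neighbours G kc a
    ... | y , ay , y-injective =
      commonNeighbourPaths (cone G) (suc ∘ y) refl ay (λ _ → refl)
        (λ i j i≢j → y-injective i j i≢j ∘ suc-injective)
    conePaths (suc a) (suc b) a≢b =
      InternallyDisjointPaths-∷ (cone G) viaApex isViaApex (lift-InternallyDisjointPaths (paths a b (a≢b ∘ cong suc)))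
        (λ i eq → zero∉map-suc _ (subst (zero ∈_) eq (there (here refl))))
        (λ i x x∈W x∈P → endpoint x∈W x∈P)
      where
      viaApex : List (Vertex (cone G))
      viaApex = suc a ∷ zero ∷ suc b ∷ []
      isViaApex : IsPathBetween (cone G) (suc a) (suc b) viaApex
      isViaApex = ((λ ()) , ((λ ()) ∷ a≢b ∷ []) ∷ ((λ ()) ∷ []) ∷ [] ∷ [] , refl ∷ refl ∷ [-]) , refl , refl
      endpoint : ∀ {x p} → x ∈ viaApex → x ∈ map suc p → (x ≡ suc a) ⊎ (x ≡ suc b)
      endpoint (here x≡a)                 _ = inj₁ x≡a
      endpoint {p = p} (there (here refl)) z∈ = ⊥-elim (zero∉map-suc p z∈)
      endpoint (there (there (here x≡b))) _ = inj₂ x≡b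

base : ∀ {m} → List (Fin (suc m)) → List (Fin m)
base []           = []
base (zero  ∷ xs) = base xs
base (suc x ∷ xs) = x ∷ base xs

module _ {m : ℕ} where

  ∈-base⁻ : ∀ {x : Fin m} xs → x ∈ base xs → suc x ∈ xs
  ∈-base⁻ (zero  ∷ xs) x∈ = there (∈-base⁻ xs x∈)
  ∈-base⁻ (suc _ ∷ xs) (here refl) = here refl
  ∈-base⁻ (suc _ ∷ xs) (there x∈)  = there (∈-base⁻ xs x∈)

  base-Unique : ∀ {xs : List (Fin (suc m))} → Unique xs → Unique (base xs)
  base-Unique {[]}         _               = []
  base-Unique {zero  ∷ xs} (_ ∷ uniq)      = base-Unique uniq
  base-Unique {suc x ∷ xs} (x∉xs ∷ uniq) =
    All.tabulate (λ y∈ x≡y → All.lookup x∉xs (∈-base⁻ xs y∈) (cong suc x≡y)) ∷ base-Unique uniq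

  map-suc-base : ∀ (xs : List (Fin (suc m))) → zero ∉ xs → map suc (base xs) ≡ xs
  map-suc-base []           _     = refl
  map-suc-base (zero  ∷ xs) z∉xs  = ⊥-elim (z∉xs (here refl))
  map-suc-base (suc x ∷ xs) z∉xs  = cong (suc x ∷_) (map-suc-base xs (z∉xs ∘ there))

  length-base : ∀ (xs : List (Fin (suc m))) → zero ∉ xs → length (base xs) ≡ length xs
  length-base xs z∉xs = trans (≡.sym (length-map suc (base xs))) (cong length (map-suc-base xs z∉xs))

  length≤suc-length-base : ∀ {xs : List (Fin (suc m))} → Unique xs → length xs ≤ suc (length (base xs))
  length≤suc-length-base {[]}         _              = z≤n
  length≤suc-length-base {zero  ∷ xs} (z∉xs ∷ _)   =
    s≤s (≤-reflexive (≡.sym (length-base xs (λ z∈ → All.lookup z∉xs z∈ refl))))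
  length≤suc-length-base {suc x ∷ xs} (_ ∷ uniq)   = s≤s (length≤suc-length-base uniq)

  -- At most one shared vertex is the apex.
  ShareAtLeast-base : ∀ r (P Q : List (Fin m)) →
    ShareAtLeast (suc r) (zero ∷ map suc P) (zero ∷ map suc Q) → ShareAtLeast r P Q
  ShareAtLeast-base r P Q (S , uniq , r<|S| , S⊆P , S⊆Q) =
    base S , base-Unique uniq , ≤-pred (≤-trans r<|S| (length≤suc-length-base uniq)) ,
    All.tabulate (unlift S⊆P) , All.tabulate (unlift S⊆Q)
    where
    unlift : ∀ {R x} → All (_∈ zero ∷ map suc R) S → x ∈ base S → x ∈ R
    unlift S⊆R x∈ with All.lookup S⊆R (∈-base⁻ S x∈)
    ... | there sx∈ = ∈-map-suc⁻ sx∈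

module _ (G : Graph) where

  lift-IsCycle : ∀ {p} → IsPath G p → 2 ≤ length p → IsCycle (cone G) (zero ∷ map suc p)
  lift-IsCycle {_ ∷ []} _ (s≤s ())
  lift-IsCycle {x ∷ y ∷ p} (_ , uniq , lk) _ =
    s≤s (s≤s (s≤s z≤n)) ,
    All.tabulate (λ {w} w∈ z≡w → zero∉map-suc (x ∷ y ∷ p) (subst (_∈ map suc (x ∷ y ∷ p)) (≡.sym z≡w) w∈)) ∷
      Unique.map⁺ suc-injective uniq ,
    refl ∷ Linked.map⁺ lk ,
    zero , suc (proj₁ (last-∷ y p)) , refl ,
    trans (last-map suc (x ∷ y ∷ p)) (cong (Maybe.map suc) (proj₂ (last-∷ y p))) , refl

  module _ {P : List (Vertex G)} (longest : LongestPath G P) where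
    open import Data.List.Membership.DecPropositional (_≟_ {suc (n G)}) using (_∈?_)

    apexFree-length≤ : ∀ {l} → IsPath (cone G) l → zero ∉ l → length l ≤ length P
    apexFree-length≤ {l} isL z∉l = begin
      length l         ≡⟨ length-base l z∉l ⟨
      length (base l)  ≤⟨ LongestPath⇒length≤ G longest (unlift-IsPath G isBase) ⟩
      length P         ∎
      where
      open ≤-Reasoning
      isBase : IsPath (cone G) (map suc (base l))
      isBase = subst (IsPath (cone G)) (≡.sym (map-suc-base l z∉l)) isL

    cone-cycle-length≤ : ∀ {D} → IsCycle (cone G) D → length D ≤ suc (length P)
    cone-cycle-length≤ {D} cD@(3≤|D| , uniq , lk , _) with zero ∈? D
    ... | no z∉D = m≤n⇒m≤1+n (apexFree-length≤ (length>0⇒≢[] 3≤|D| , uniq , lk) z∉D)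
    ... | yes z∈D with ∈-∃++ z∈D
    ... | xs , ys , refl with IsCycle-delete (cone G) xs zero ys cD
    ... | isPath , z∉ = begin
      length (xs ++ zero ∷ ys)  ≡⟨ length-++-comm xs (zero ∷ ys) ⟩
      suc (length (ys ++ xs))   ≤⟨ s≤s (apexFree-length≤ isPath z∉) ⟩
      suc (length P)            ∎
      where open ≤-Reasoning

    lift-LongestCycle : 2 ≤ length P → LongestCycle (cone G) (zero ∷ map suc P)
    lift-LongestCycle 2≤|P| =
      lift-IsCycle (proj₁ longest) 2≤|P| ,
      λ D cD → subst (length D ≤_) (cong suc (≡.sym (length-map suc P))) (cone-cycle-length≤ cD)

LongestPath-length≥2 : ∀ {k} (G : Graph) → KConnected (suc k) G → ∀ {P} → LongestPath G P → 2 ≤ length P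
LongestPath-length≥2 G kc@(k<n , _) longest = LongestPath⇒length≤ G longest (edgePath G vw)
  where
  v : Vertex G
  v = fromℕ< (≤-trans (s≤s z≤n) k<n)
  vw : Adj G v (proj₁ (KConnected⇒neighbours G kc v) zero)
  vw = proj₁ (proj₂ (KConnected⇒neighbours G kc v)) zero

mainTheorem1 : (k r : ℕ) → 1 ≤ k → r ≤ k →
    (∀ (G : Graph) → KConnected (suc k) G → ∀ C D →
      LongestCycle G C → LongestCycle G D → ShareAtLeast (suc r) C D) →
    ∀ (G : Graph) → KConnected k G → ∀ P Q →
      LongestPath G P → LongestPath G Q → ShareAtLeast r P Q
mainTheorem1 (suc k) r _ _ cyclesShare G kc P Q longestP longestQ =
  ShareAtLeast-base r P Q
    (cyclesShare (cone G) (cone-KConnected G kc) _ _ (longestCycle longestP) (longestCycle longestQ))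
  where
  longestCycle : ∀ {R} → LongestPath G R → LongestCycle (cone G) (zero ∷ map suc R)
  longestCycle longest = lift-LongestCycle G longest (LongestPath-length≥2 G kc longest)
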